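{- Let $m<n$ be positive integers and let $G$ be a digraph with $V(G)=[n]$ such that its induced subgraph on $[m]$ is the loopless double path $\overrightarrow{P}_{m,\emptyset}$ and $N_G[i]\subseteq[m]$ for all $i\in[m-1]$. If $A\in\mathcal M(G)$ and $X=(x_{ij})\in\overline{\mathcal M}(G^c)$ satisfy $AX^\top-X^\top A=O$, then $x_{ij}=0$ for all $i,j\in[m]$ with $|i-j|$ odd. Moreover, if $N^+_G[m]=N^-_G[m]=\{m-1,m+1\}$ and $m+1$ has a loop in $G$, then $x_{ij}=0$ for all $i,j\in[m+1]$ with $|i-j|$ odd.
   Context: A digraph $G$ has vertex set $[n]$ and arc set $E(G)\subseteq[n]\times[n]$ (arcs $(v,v)$ are loops). $N^+_G[v]=\{u:(v,u)\in E(G)\}$, $N^-_G[v]=\{w:(w,v)\in E(G)\}$, $N_G[v]=N^+_G[v]\cup N^-_G[v]$. $\mathcal M(G)$ is the set of real $n\times n$ matrices $A=(a_{ij})$ with $a_{ij}\ne0$ iff $(i,j)\in E(G)$; $\overline{\mathcal M}(G^c)$ is the set of real $n\times n$ matrices $X$ with $x_{ij}=0$ whenever $(i,j)\in E(G)$. The double path $\overrightarrow{P}_{m,\emptyset}$ has vertex set $[m]$ and arcs $\{(i,i+1),(i+1,i):i\in[m-1]\}$ and no loops. -}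

module Defs where

open import Level using (0ℓ)
open import Algebra.Bundles using (CommutativeRing)
open import Relation.Binary.Structures using (IsStrictTotalOrder)
open import Data.Nat as ℕ using (ℕ; zero; suc)
open import Data.Fin using (Fin; toℕ)
open import Data.Product using (∃; Σ; _×_; _,_)
open import Data.Sum using (_⊎_)
open import Relation.Nullary using (¬_)
open import Relation.Binary.PropositionalEquality using (_≡_)

-- An axiomatisation of the real numbers: a complete (Dedekind /
-- least-upper-bound) ordered field.  Every model is isomorphic to ℝ.

record RealNumbers : Set₁ where
  field
    realRing : CommutativeRing 0ℓ 0ℓ
  open CommutativeRing realRing public
  field
    _<_                  : Carrier → Carrier → Set
    <-isStrictTotalOrder : IsStrictTotalOrder _≈_ _<_
    0≉1                  : ¬ (0# ≈ 1#)
    inverse              : ∀ x → ¬ (x ≈ 0#) → ∃ λ y → (x * y) ≈ 1#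
    +-mono-<             : ∀ {x y} z → x < y → (x + z) < (y + z)
    *-pos                : ∀ {x y} → 0# < x → 0# < y → 0# < (x * y)

  _≤_ : Carrier → Carrier → Set
  x ≤ y = (x < y) ⊎ (x ≈ y)

  field
    lub : (P : Carrier → Set) → ∃ P → (∃ λ b → ∀ x → P x → x ≤ b) →
          ∃ λ s → (∀ x → P x → x ≤ s) × (∀ b → (∀ x → P x → x ≤ b) → s ≤ b)

module _ (ℝ : RealNumbers) where
  open RealNumbers ℝ

  Matrix : ℕ → Set
  Matrix n = Fin n → Fin n → Carrier

  ∑ : ∀ n → (Fin n → Carrier) → Carrier
  ∑ zero    f = 0#
  ∑ (suc n) f = f Fin.zero + ∑ n (λ k → f (Fin.suc k))

  infixl 7 _⊗_
  _⊗_ : ∀ {n} → Matrix n → Matrix n → Matrix n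
  _⊗_ {n} A B i j = ∑ n (λ k → A i k * B k j)

  _ᵀ : ∀ {n} → Matrix n → Matrix n
  (A ᵀ) i j = A j i

  _⊖_ : ∀ {n} → Matrix n → Matrix n → Matrix n
  (A ⊖ B) i j = A i j - B i j

  IsZeroMatrix : ∀ {n} → Matrix n → Set
  IsZeroMatrix A = ∀ i j → A i j ≈ 0#

  -- A digraph on vertex set [n]: vertex v : Fin n stands for the integer
  -- toℕ v + 1 ∈ {1,…,n}; arcs given by a relation (loops allowed).
  -- 𝓜(G): a_ij ≠ 0 iff (i,j) ∈ E(G)
  InM : ∀ {n} → (Fin n → Fin n → Set) → Matrix n → Set
  InM E A = ∀ i j → (¬ (A i j ≈ 0#) → E i j) × (E i j → ¬ (A i j ≈ 0#))

  InMbarComp : ∀ {n} → (Fin n → Fin n → Set) → Matrix n → Set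
  InMbarComp E X = ∀ i j → E i j → X i j ≈ 0#

lab : ∀ {n} → Fin n → ℕ
lab v = suc (toℕ v)

Odd : ℕ → Set
Odd k = ∃ λ t → k ≡ suc (2 ℕ.* t)

InducedDoublePath : ∀ {n} → (Fin n → Fin n → Set) → ℕ → Set
InducedDoublePath E m = ∀ i j → lab i ℕ.≤ m → lab j ℕ.≤ m →
  (E i j → (lab j ≡ suc (lab i) ⊎ lab i ≡ suc (lab j))) ×
  ((lab j ≡ suc (lab i) ⊎ lab i ≡ suc (lab j)) → E i j)

ClosedNbhds : ∀ {n} → (Fin n → Fin n → Set) → ℕ → Set
ClosedNbhds E m = ∀ i j → lab i ℕ.≤ m ℕ.∸ 1 → (E i j ⊎ E j i) → lab j ℕ.≤ m

OutNbhdOfm : ∀ {n} → (Fin n → Fin n → Set) → ℕ → Set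
OutNbhdOfm E m = ∀ k → ((∃ λ v → ∃ λ u → lab v ≡ m × lab u ≡ k × E v u) → (k ≡ m ℕ.∸ 1 ⊎ k ≡ suc m))
                     × ((k ≡ m ℕ.∸ 1 ⊎ k ≡ suc m) → (∃ λ v → ∃ λ u → lab v ≡ m × lab u ≡ k × E v u))

InNbhdOfm : ∀ {n} → (Fin n → Fin n → Set) → ℕ → Set
InNbhdOfm E m = ∀ k → ((∃ λ v → ∃ λ w → lab v ≡ m × lab w ≡ k × E w v) → (k ≡ m ℕ.∸ 1 ⊎ k ≡ suc m))
                    × ((k ≡ m ℕ.∸ 1 ⊎ k ≡ suc m) → (∃ λ v → ∃ λ w → lab v ≡ m × lab w ≡ k × E w v))

-- Entry (i, j) of A Xᵀ = Xᵀ A reads  ∑ₖ a_ik x_jk = ∑ₖ x_ki a_kj.  Induct on the larger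
-- endpoint r of a pair c < r at odd distance in the path.  Distance 1 is an arc, where X
-- vanishes.  Otherwise put q = r - 1: the equations at (c, q) and (q, c) contain
-- x_rc a_rq and a_qr x_cr, and every other term pairs a neighbour of c with q or a
-- neighbour of q with c, i.e. a pair at odd distance with larger endpoint at most q, so it
-- vanishes; as a_rq, a_qr ≠ 0, so do x_rc and x_cr.  The vertex m + 1 is handled by the
-- same step, because N[m] = {m - 1, m + 1} plays the role of the path neighbourhood.
module Submission where

open import Defs
open import Data.Nat using (ℕ; suc; _≤_; _<_; ∣_-_∣)
open import Data.Fin using (Fin)
open import Data.Product using (_×_)
open import Relation.Binary.PropositionalEquality using (_≡_)

import Algebra.Properties.Group as GroupProperties
open import Data.Fin as Fin using (inject₁)
open import Data.Fin.Properties as Fin using (toℕ-injective; toℕ-inject₁)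
open import Data.Nat as ℕ using (zero; _∸_; z≤n; s≤s; s≤s⁻¹; parity)
open import Data.Nat.Properties
  using ( ≤-refl; ≤-reflexive; ≤-trans; <⇒≤; <-trans; <-≤-trans; n≤1+n; <-cmp
        ; m≤n⇒m<n∨m≡n; suc-injective; ∸-monoˡ-≤)
open import Data.Parity using (1ℙ; _⁻¹)
open import Data.Parity.Properties
  using (suc-homo-⁻¹; ⁻¹-selfInverse; ⁻¹-injective; p≢p⁻¹; +-homo-+; *-homo-*)
open import Data.Product using (∃; _,_; proj₁; proj₂; swap)
open import Data.Sum as Sum using (_⊎_; inj₁; inj₂)
open import Function using (_∘_)
open import Relation.Binary using (tri<; tri≈; tri>)
open import Relation.Binary.Bundles using (Setoid)
open import Relation.Binary.PropositionalEquality as ≡ using (_≢_; refl; cong; subst; subst₂)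
open import Relation.Binary.Structures using (IsStrictTotalOrder)
open import Relation.Nullary using (¬_; yes; no; contradiction)

Adjacent : ℕ → ℕ → Set
Adjacent a b = b ≡ suc a ⊎ a ≡ suc b

adjacent-sym : ∀ {a b} → Adjacent a b → Adjacent b a
adjacent-sym = Sum.swap

OppositeParity : ℕ → ℕ → Set
OppositeParity a b = parity b ≡ parity a ⁻¹

parity-suc : ∀ a → parity (suc a) ≡ parity a ⁻¹
parity-suc a = ≡.sym (⁻¹-selfInverse (suc-homo-⁻¹ a))

oppositeParity-sym : ∀ {a b} → OppositeParity a b → OppositeParity b a
oppositeParity-sym eq = ≡.sym (⁻¹-selfInverse (≡.sym eq))

adjacent⇒oppositeParity : ∀ {a b} → Adjacent a b → OppositeParity a b
adjacent⇒oppositeParity {a} (inj₁ refl) = parity-suc a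
adjacent⇒oppositeParity {b = b} (inj₂ refl) = oppositeParity-sym {b} {suc b} (parity-suc b)

oppositeParity⇒≢ : ∀ {a b} → OppositeParity a b → a ≢ b
oppositeParity⇒≢ {a} eq refl = p≢p⁻¹ (parity a) eq

oppositeParity-suc : ∀ {a b} → OppositeParity a (suc b) → parity a ≡ parity b
oppositeParity-suc {b = b} eq = ⁻¹-injective (≡.trans (≡.sym eq) (parity-suc b))

<∧parity≡⇒suc< : ∀ {a b} → a < b → parity a ≡ parity b → suc a < b
<∧parity≡⇒suc< {a} a<b eq with m≤n⇒m<n∨m≡n a<b
... | inj₁ suc-a<b = suc-a<b
... | inj₂ refl = contradiction (≡.trans eq (parity-suc a)) (p≢p⁻¹ (parity a))

odd⇒parity≡1ℙ : ∀ {k} → Odd k → parity k ≡ 1ℙ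
odd⇒parity≡1ℙ (t , refl) = ≡.trans (+-homo-+ 1 (2 ℕ.* t)) (cong _⁻¹ (*-homo-* 2 t))

odd-distance⇒oppositeParity : ∀ a b → Odd ∣ a - b ∣ → OppositeParity a b
odd-distance⇒oppositeParity zero    b       odd = odd⇒parity≡1ℙ odd
odd-distance⇒oppositeParity (suc a) zero    odd = oppositeParity-sym {0} {suc a} (odd⇒parity≡1ℙ odd)
odd-distance⇒oppositeParity (suc a) (suc b) odd = begin
  parity (suc b)     ≡⟨ parity-suc b ⟩
  parity b ⁻¹        ≡⟨ cong _⁻¹ (odd-distance⇒oppositeParity a b odd) ⟩
  parity a ⁻¹ ⁻¹     ≡⟨ cong _⁻¹ (≡.sym (parity-suc a)) ⟩
  parity (suc a) ⁻¹  ∎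
  where open ≡.≡-Reasoning

module _ (ℝ : RealNumbers) where
  open RealNumbers ℝ hiding (_<_; _≤_; refl)
  open import Relation.Binary.Reasoning.Setoid setoid

  ∑-≈0 : ∀ k (f : Fin k → Carrier) → (∀ i → f i ≈ 0#) → ∑ ℝ k f ≈ 0#
  ∑-≈0 zero    f f≈0 = Setoid.refl setoid
  ∑-≈0 (suc k) f f≈0 =
    trans (+-cong (f≈0 Fin.zero) (∑-≈0 k _ (λ i → f≈0 (Fin.suc i)))) (+-identityˡ 0#)

  ∑-single : ∀ k (f : Fin k → Carrier) p → (∀ i → i ≢ p → f i ≈ 0#) → ∑ ℝ k f ≈ f p
  ∑-single (suc k) f Fin.zero f≈0 =
    trans (+-congˡ (∑-≈0 k _ (λ i → f≈0 (Fin.suc i) λ ()))) (+-identityʳ _)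
  ∑-single (suc k) f (Fin.suc p) f≈0 =
    trans (+-cong (f≈0 Fin.zero λ ())
                  (∑-single k _ p λ i i≢p → f≈0 (Fin.suc i) (i≢p ∘ Fin.suc-injective)))
          (+-identityˡ _)

  x≉0∧x*y≈0⇒y≈0 : ∀ {x y} → ¬ (x ≈ 0#) → x * y ≈ 0# → y ≈ 0#
  x≉0∧x*y≈0⇒y≈0 {x} {y} x≉0 xy≈0 with inverse x x≉0
  ... | x⁻¹ , xx⁻¹≈1 = begin
    y                ≈⟨ sym (*-identityˡ y) ⟩
    1# * y           ≈⟨ *-congʳ (sym xx⁻¹≈1) ⟩
    (x * x⁻¹) * y    ≈⟨ *-congʳ (*-comm x x⁻¹) ⟩
    (x⁻¹ * x) * y    ≈⟨ *-assoc x⁻¹ x y ⟩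
    x⁻¹ * (x * y)    ≈⟨ *-congˡ xy≈0 ⟩
    x⁻¹ * 0#         ≈⟨ zeroʳ x⁻¹ ⟩
    0#               ∎

module Commuting (ℝ : RealNumbers) {n} (E : Fin n → Fin n → Set) (A X : Matrix ℝ n)
  (A∈𝓜 : InM ℝ E A)
  (AXᵀ≈XᵀA : IsZeroMatrix ℝ (_⊖_ ℝ (_⊗_ ℝ A (_ᵀ ℝ X)) (_⊗_ ℝ (_ᵀ ℝ X) A))) where

  open RealNumbers ℝ hiding (_<_; _≤_; refl)
  open import Relation.Binary.Reasoning.Setoid setoid

  row-column : ∀ i j → ∑ ℝ n (λ k → A i k * X j k) ≈ ∑ ℝ n (λ k → X k i * A k j)
  row-column i j = GroupProperties.x∙y⁻¹≈ε⇒x≈y +-group _ _ (AXᵀ≈XᵀA i j)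

  A*≈0 : ∀ {i k} y → (E i k → y ≈ 0#) → A i k * y ≈ 0#
  A*≈0 {i} {k} y arc⇒y≈0 with IsStrictTotalOrder._≟_ <-isStrictTotalOrder (A i k) 0#
  ... | yes a≈0 = trans (*-congʳ a≈0) (zeroˡ y)
  ... | no  a≉0 = trans (*-congˡ (arc⇒y≈0 (proj₁ (A∈𝓜 i k) a≉0))) (zeroʳ (A i k))

  *A≈0 : ∀ {i k} y → (E i k → y ≈ 0#) → y * A i k ≈ 0#
  *A≈0 y arc⇒y≈0 = trans (*-comm y _) (A*≈0 y arc⇒y≈0)

  X≈0-by-row : ∀ {c q r} → E q r →
    (∀ k → k ≢ r → E q k → X c k ≈ 0#) → (∀ k → E k c → X k q ≈ 0#) → X c r ≈ 0#
  X≈0-by-row {c} {q} {r} q→r off-r in-c = x≉0∧x*y≈0⇒y≈0 ℝ (proj₂ (A∈𝓜 q r) q→r) (begin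
    A q r * X c r                ≈⟨ ∑-single ℝ n _ r (λ k k≢r → A*≈0 _ (off-r k k≢r)) ⟨
    ∑ ℝ n (λ k → A q k * X c k)  ≈⟨ row-column q c ⟩
    ∑ ℝ n (λ k → X k q * A k c)  ≈⟨ ∑-≈0 ℝ n _ (λ k → *A≈0 _ (in-c k)) ⟩
    0#                           ∎)

  X≈0-by-column : ∀ {c q r} → E r q →
    (∀ k → E c k → X q k ≈ 0#) → (∀ k → k ≢ r → E k q → X k c ≈ 0#) → X r c ≈ 0#
  X≈0-by-column {c} {q} {r} r→q out-c off-r = x≉0∧x*y≈0⇒y≈0 ℝ (proj₂ (A∈𝓜 r q) r→q) (begin
    A r q * X r c                ≈⟨ *-comm _ _ ⟩
    X r c * A r q                ≈⟨ ∑-single ℝ n _ r (λ k k≢r → *A≈0 _ (off-r k k≢r)) ⟨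
    ∑ ℝ n (λ k → X k c * A k q)  ≈⟨ row-column c q ⟨
    ∑ ℝ n (λ k → A c k * X q k)  ≈⟨ ∑-≈0 ℝ n _ (λ k → A*≈0 _ (out-c k)) ⟩
    0#                           ∎)

lab-injective : ∀ {n} {i j : Fin n} → lab i ≡ lab j → i ≡ j
lab-injective = toℕ-injective ∘ suc-injective

predecessor : ∀ {n} (i : Fin n) → 1 < lab i → ∃ λ (q : Fin n) → suc (lab q) ≡ lab i
predecessor Fin.zero    (s≤s ())
predecessor (Fin.suc i) _ = inject₁ i , cong (suc ∘ suc) (toℕ-inject₁ i)

module DoublePath (ℝ : RealNumbers) (m : ℕ) {n} (E : Fin n → Fin n → Set)
  (path : InducedDoublePath E m) (closed : ClosedNbhds E m)
  (A X : Matrix ℝ n) (A∈𝓜 : InM ℝ E A) (X∈𝓜̄ : InMbarComp ℝ E X)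
  (AXᵀ≈XᵀA : IsZeroMatrix ℝ (_⊖_ ℝ (_⊗_ ℝ A (_ᵀ ℝ X)) (_⊗_ ℝ (_ᵀ ℝ X) A))) where

  open RealNumbers ℝ using (_≈_; 0#)
  open Commuting ℝ E A X A∈𝓜 AXᵀ≈XᵀA

  BothZero : Fin n → Fin n → Set
  BothZero i j = X i j ≈ 0# × X j i ≈ 0#

  path-arc : ∀ {i j} → lab i ≤ m → lab j ≤ m → Adjacent (lab i) (lab j) → E i j
  path-arc i≤m j≤m = proj₂ (path _ _ i≤m j≤m)

  path-neighbour : ∀ {i k} → lab i < m → E i k ⊎ E k i → Adjacent (lab i) (lab k)
  path-neighbour {i} {k} i<m arc with closed i k (∸-monoˡ-≤ 1 i<m) arc
  path-neighbour i<m (inj₁ i→k) | k≤m = proj₁ (path _ _ (<⇒≤ i<m) k≤m) i→k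
  path-neighbour i<m (inj₂ k→i) | k≤m = adjacent-sym (proj₁ (path _ _ k≤m (<⇒≤ i<m)) k→i)

  adjacent-bothZero : ∀ {i j} → lab i ≤ m → lab j ≤ m → Adjacent (lab j) (lab i) → BothZero i j
  adjacent-bothZero i≤m j≤m adj =
    X∈𝓜̄ _ _ (path-arc i≤m j≤m (adjacent-sym adj)) , X∈𝓜̄ _ _ (path-arc j≤m i≤m adj)

  BothZeroUpTo : ℕ → Set
  BothZeroUpTo p = ∀ {i j} → lab j < lab i → lab i ≤ p → OppositeParity (lab j) (lab i) → BothZero i j

  bothZero-beyond : ∀ {c q r} → E q r → E r q →
    (∀ {k} → k ≢ r → E q k ⊎ E k q → suc (lab k) ≡ lab q) →
    lab q ≤ m → lab c < lab q → parity (lab c) ≡ parity (lab q) →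
    BothZeroUpTo (lab q) → BothZero r c
  bothZero-beyond {c} {q} {r} q→r r→q q-neighbours q≤m c<q c∼q bothZero-below =
      X≈0-by-column r→q (λ k c→k → proj₁ (near-c (inj₁ c→k)))
                        (λ k k≢r k→q → proj₁ (near-q k≢r (inj₂ k→q)))
    , X≈0-by-row q→r (λ k k≢r q→k → proj₂ (near-q k≢r (inj₁ q→k)))
                     (λ k k→c → proj₂ (near-c (inj₂ k→c)))
    where
    -- Equal parity keeps c two steps below q, so the neighbours of c stay below q.
    gap : suc (lab c) < lab q
    gap = <∧parity≡⇒suc< c<q c∼q

    near-c : ∀ {k} → E c k ⊎ E k c → BothZero q k
    near-c {k} arc = bothZero-below k<q ≤-refl
      (≡.trans (≡.sym c∼q) (adjacent⇒oppositeParity (adjacent-sym adj)))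
      where
      adj : Adjacent (lab c) (lab k)
      adj = path-neighbour (<-≤-trans c<q q≤m) arc
      k<q : lab k < lab q
      k<q with adj
      ... | inj₁ k≡c+1 = subst (_< lab q) (≡.sym k≡c+1) gap
      ... | inj₂ c≡k+1 = <-trans (subst (lab k <_) (≡.sym c≡k+1) ≤-refl) c<q

    near-q : ∀ {k} → k ≢ r → E q k ⊎ E k q → BothZero k c
    near-q {k} k≢r arc = bothZero-below c<k (subst (lab k ≤_) k+1≡q (n≤1+n (lab k)))
      (≡.trans (oppositeParity-sym {lab k} {lab q}
                 (subst (OppositeParity (lab k)) k+1≡q (parity-suc (lab k))))
               (cong _⁻¹ (≡.sym c∼q)))
      where
      k+1≡q : suc (lab k) ≡ lab q
      k+1≡q = q-neighbours k≢r arc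
      c<k : lab c < lab k
      c<k = s≤s⁻¹ (subst (suc (lab c) <_) (≡.sym k+1≡q) gap)

  bothZero-step : ∀ {i j} → lab i ≤ m → lab j < lab i → OppositeParity (lab j) (lab i) →
    (∀ {q} → suc (lab q) ≡ lab i → BothZeroUpTo (lab q)) → BothZero i j
  bothZero-step {i} {j} i≤m j<i opp bothZero-below with m≤n⇒m<n∨m≡n j<i
  ... | inj₂ j+1≡i = adjacent-bothZero i≤m (≤-trans (<⇒≤ j<i) i≤m) (inj₁ (≡.sym j+1≡i))
  ... | inj₁ j+1<i with predecessor i (≤-trans (s≤s (s≤s z≤n)) j+1<i)
  ...   | q , q+1≡i = bothZero-beyond
            (path-arc q≤m i≤m (inj₁ (≡.sym q+1≡i))) (path-arc i≤m q≤m (inj₂ (≡.sym q+1≡i)))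
            q-neighbours q≤m j<q
            (oppositeParity-suc {lab j} {lab q} (subst (OppositeParity (lab j)) (≡.sym q+1≡i) opp))
            (bothZero-below q+1≡i)
    where
    q<m : lab q < m
    q<m = subst (_≤ m) (≡.sym q+1≡i) i≤m
    q≤m : lab q ≤ m
    q≤m = <⇒≤ q<m
    j<q : lab j < lab q
    j<q = s≤s⁻¹ (subst (suc (lab j) <_) (≡.sym q+1≡i) j+1<i)
    q-neighbours : ∀ {k} → k ≢ i → E q k ⊎ E k q → suc (lab k) ≡ lab q
    q-neighbours k≢i arc with path-neighbour q<m arc
    ... | inj₁ k≡q+1 = contradiction (lab-injective (≡.trans k≡q+1 q+1≡i)) k≢i
    ... | inj₂ q≡k+1 = ≡.sym q≡k+1

  bothZero-upTo : ∀ p → p ≤ m → BothZeroUpTo p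
  bothZero-upTo zero    _   _ ()
  bothZero-upTo (suc p) p<m j<i i≤p+1 opp with m≤n⇒m<n∨m≡n i≤p+1
  ... | inj₁ i≤p   = bothZero-upTo p (<⇒≤ p<m) j<i (s≤s⁻¹ i≤p) opp
  ... | inj₂ i≡p+1 = bothZero-step (subst (_≤ m) (≡.sym i≡p+1) p<m) j<i opp λ q+1≡i →
    subst BothZeroUpTo (≡.sym (suc-injective (≡.trans q+1≡i i≡p+1))) (bothZero-upTo p (<⇒≤ p<m))

  bothZero-path : ∀ {i j} → lab i ≤ m → lab j ≤ m → OppositeParity (lab i) (lab j) → BothZero i j
  bothZero-path {i} {j} i≤m j≤m opp with <-cmp (lab i) (lab j)
  ... | tri< i<j _ _ = swap (bothZero-upTo m ≤-refl i<j j≤m opp)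
  ... | tri≈ _ i≡j _ = contradiction i≡j (oppositeParity⇒≢ opp)
  ... | tri> _ _ j<i = bothZero-upTo m ≤-refl j<i i≤m (oppositeParity-sym {lab i} {lab j} opp)

  module ExtendedPath (out : OutNbhdOfm E m) (inn : InNbhdOfm E m) where

    arc-into-m+1 : ∀ {v u} → lab v ≡ m → lab u ≡ suc m → E v u
    arc-into-m+1 v≡m u≡m+1 with proj₂ (out (suc m)) (inj₂ refl)
    ... | v′ , u′ , v′≡m , u′≡m+1 , v′→u′ =
      subst₂ E (lab-injective (≡.trans v′≡m (≡.sym v≡m)))
               (lab-injective (≡.trans u′≡m+1 (≡.sym u≡m+1))) v′→u′

    arc-from-m+1 : ∀ {v u} → lab v ≡ suc m → lab u ≡ m → E v u
    arc-from-m+1 v≡m+1 u≡m with proj₂ (inn (suc m)) (inj₂ refl)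
    ... | u′ , v′ , u′≡m , v′≡m+1 , v′→u′ =
      subst₂ E (lab-injective (≡.trans v′≡m+1 (≡.sym v≡m+1)))
               (lab-injective (≡.trans u′≡m (≡.sym u≡m))) v′→u′

    neighbour-of-m : ∀ {q k} → lab q ≡ m → E q k ⊎ E k q → lab k ≡ m ∸ 1 ⊎ lab k ≡ suc m
    neighbour-of-m q≡m (inj₁ q→k) = proj₁ (out _) (_ , _ , q≡m , refl , q→k)
    neighbour-of-m q≡m (inj₂ k→q) = proj₁ (inn _) (_ , _ , q≡m , refl , k→q)

    bothZero-from-m+1 : ∀ {s b} → lab s ≡ suc m → lab b ≤ m → OppositeParity (lab b) (lab s) →
      BothZero s b
    bothZero-from-m+1 {s} {b} s≡m+1 b≤m opp
      with predecessor s (subst (1 <_) (≡.sym s≡m+1) (s≤s (≤-trans (s≤s z≤n) b≤m)))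
    ... | q , q+1≡s with m≤n⇒m<n∨m≡n b≤m
    ...   | inj₂ b≡m = X∈𝓜̄ _ _ (arc-from-m+1 s≡m+1 b≡m) , X∈𝓜̄ _ _ (arc-into-m+1 b≡m s≡m+1)
    ...   | inj₁ b<m = bothZero-beyond
              (arc-into-m+1 q≡m s≡m+1) (arc-from-m+1 s≡m+1 q≡m) q-neighbours
              (≤-reflexive q≡m) (subst (lab b <_) (≡.sym q≡m) b<m)
              (oppositeParity-suc {lab b} {lab q} (subst (OppositeParity (lab b)) (≡.sym q+1≡s) opp))
              (subst BothZeroUpTo (≡.sym q≡m) (bothZero-upTo m ≤-refl))
      where
      q≡m : lab q ≡ m
      q≡m = suc-injective (≡.trans q+1≡s s≡m+1)
      q-neighbours : ∀ {k} → k ≢ s → E q k ⊎ E k q → suc (lab k) ≡ lab q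
      q-neighbours k≢s arc with neighbour-of-m q≡m arc
      ... | inj₁ k≡m-1 = ≡.trans (cong suc k≡m-1) (cong (λ l → suc (l ∸ 1)) (≡.sym q≡m))
      ... | inj₂ k≡m+1 = contradiction (lab-injective (≡.trans k≡m+1 (≡.sym s≡m+1))) k≢s

    bothZero-extended : ∀ {i j} → lab i ≤ suc m → lab j ≤ suc m → OppositeParity (lab i) (lab j) →
      BothZero i j
    bothZero-extended {i} {j} i≤m+1 j≤m+1 opp with m≤n⇒m<n∨m≡n i≤m+1 | m≤n⇒m<n∨m≡n j≤m+1
    ... | inj₁ i≤m   | inj₁ j≤m   = bothZero-path (s≤s⁻¹ i≤m) (s≤s⁻¹ j≤m) opp
    ... | inj₂ i≡m+1 | inj₁ j≤m   =
      bothZero-from-m+1 i≡m+1 (s≤s⁻¹ j≤m) (oppositeParity-sym {lab i} {lab j} opp)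
    ... | inj₁ i≤m   | inj₂ j≡m+1 = swap (bothZero-from-m+1 j≡m+1 (s≤s⁻¹ i≤m) opp)
    ... | inj₂ i≡m+1 | inj₂ j≡m+1 =
      contradiction (≡.trans i≡m+1 (≡.sym j≡m+1)) (oppositeParity⇒≢ opp)

lemma4p4 : (ℝ : RealNumbers) → (m n : ℕ) → 1 ≤ m → m < n →
    (E : Fin n → Fin n → Set) →
    InducedDoublePath E m → ClosedNbhds E m →
    (A X : Matrix ℝ n) → InM ℝ E A → InMbarComp ℝ E X →
    IsZeroMatrix ℝ (_⊖_ ℝ (_⊗_ ℝ A (_ᵀ ℝ X)) (_⊗_ ℝ (_ᵀ ℝ X) A)) →
    (∀ i j → lab i ≤ m → lab j ≤ m → Odd ∣ lab i - lab j ∣ → RealNumbers._≈_ ℝ (X i j) (RealNumbers.0# ℝ))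
    × (OutNbhdOfm E m → InNbhdOfm E m → (∀ v → lab v ≡ suc m → E v v) →
       ∀ i j → lab i ≤ suc m → lab j ≤ suc m → Odd ∣ lab i - lab j ∣ → RealNumbers._≈_ ℝ (X i j) (RealNumbers.0# ℝ))
lemma4p4 ℝ m n _ _ E path closed A X A∈𝓜 X∈𝓜̄ AXᵀ≈XᵀA =
    (λ i j i≤m j≤m odd →
      proj₁ (bothZero-path i≤m j≤m (odd-distance⇒oppositeParity (lab i) (lab j) odd)))
  , (λ out inn _ i j i≤m+1 j≤m+1 odd →
      proj₁ (ExtendedPath.bothZero-extended out inn i≤m+1 j≤m+1
               (odd-distance⇒oppositeParity (lab i) (lab j) odd)))
  where open DoublePath ℝ m E path closed A X A∈𝓜 X∈𝓜̄ AXᵀ≈XᵀA
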